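{- Let $G$ be a split graph without isolated vertices whose vertex set is partitioned into a clique $K_r$ on $r$ vertices and an independent set $S$ with $|S|=s$. Then for every integer $k\ge 3$, $\varphi(G^k)=\frac{1}{2}(r+s-1)(r+s-2)$.
   Context: All graphs are simple and finite. A split graph is a graph whose vertex set can be partitioned into a clique and an independent set. $\mathbb{N}_0$ denotes the set of non-negative integers. For non-empty $A,B\subseteq\mathbb{N}_0$, $A+B=\{a+b: a\in A, b\in B\}$. An integer additive set-indexer (IASI) of a graph $G$ is an injective function $f:V(G)\to\mathcal{P}(\mathbb{N}_0)$ with non-empty values such that the induced map $f^+(uv)=f(u)+f(v)$ on $E(G)$ is also injective. An IASI is weak if $|f^+(uv)|=\max(|f(u)|,|f(v)|)$ for every edge $uv$. An element (vertex or edge) is mono-indexed if its set-label has cardinality $1$. The sparing number $\varphi(H)$ of a graph $H$ is the minimum number of mono-indexed edges over all weak IASIs of $H$. The $k$-th power $G^k$ of $G$ has vertex set $V(G)$, two distinct vertices adjacent iff their distance in $G$ is at most $k$. -}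

module Defs where

open import Data.Nat using (ℕ; zero; suc; _+_; _⊔_; _≟_)
open import Data.Fin using (Fin) renaming (_<_ to _<ᶠ_)
open import Data.List using (List; []; _∷_; length; deduplicate; cartesianProductWith)
open import Data.List.Membership.Propositional using () renaming (_∈_ to _∈ˡ_)
open import Data.List.Relation.Unary.Unique.Propositional using (Unique)
open import Data.Product using (Σ; _×_; _,_)
open import Data.Sum using (_⊎_)
open import Relation.Binary.PropositionalEquality using (_≡_; _≢_; refl)
open import Relation.Nullary using (¬_)
open import Function.Bundles using (_⇔_)

record Graph (n : ℕ) : Set₁ where
  field
    Adj     : Fin n → Fin n → Set
    sym     : ∀ {u v} → Adj u v → Adj v u
    irrefl  : ∀ {u} → ¬ Adj u u
open Graph public

data Within {n : ℕ} (G : Graph n) : ℕ → Fin n → Fin n → Set where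
  here : ∀ {k u} → Within G k u u
  step : ∀ {k u v w} → Adj G u v → Within G k v w → Within G (suc k) u w

module _ {n : ℕ} (G : Graph n) where
  within-snoc : ∀ {k u v w} → Within G k u v → Adj G v w → Within G (suc k) u w
  within-snoc here a = step a here
  within-snoc (step a p) b = step a (within-snoc p b)

  within-rev : ∀ {k u v} → Within G k u v → Within G k v u
  within-rev here = here
  within-rev (step a p) = within-snoc (within-rev p) (sym G a)

_^^_ : ∀ {n} → Graph n → ℕ → Graph n
Adj (G ^^ k) u v = (u ≢ v) × Within G k u v
sym (G ^^ k) (u≢v , p) = (λ e → u≢v (Relation.Binary.PropositionalEquality.sym e)) , within-rev G p
irrefl (G ^^ k) (u≢u , _) = u≢u refl

NoIsolated : ∀ {n} → Graph n → Set
NoIsolated {n} G = (u : Fin n) → Σ (Fin n) (λ v → Adj G u v)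

-- Finite subsets of ℕ₀, represented by lists (the set of members).

FinSet : Set
FinSet = List ℕ

_≈ˢ_ : FinSet → FinSet → Set
A ≈ˢ B = (x : ℕ) → (x ∈ˡ A) ⇔ (x ∈ˡ B)

card : FinSet → ℕ
card A = length (deduplicate _≟_ A)

_⊕_ : FinSet → FinSet → FinSet
A ⊕ B = cartesianProductWith _+_ A B

record WeakIASI {n : ℕ} (G : Graph n) : Set where
  field
    f         : Fin n → FinSet
    nonempty  : (u : Fin n) → Σ ℕ (λ x → x ∈ˡ f u)
    f-inj     : (u v : Fin n) → f u ≈ˢ f v → u ≡ v
    f⁺-inj    : ∀ {u v u' v'} → Adj G u v → Adj G u' v' →
                (f u ⊕ f v) ≈ˢ (f u' ⊕ f v') →
                ((u ≡ u') × (v ≡ v')) ⊎ ((u ≡ v') × (v ≡ u'))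
    weak      : ∀ {u v} → Adj G u v → card (f u ⊕ f v) ≡ card (f u) ⊔ card (f v)
open WeakIASI public

-- The edge {u,v} (listed with u < v) is mono-indexed under f.
MonoEdge : ∀ {n} {G : Graph n} → WeakIASI G → Fin n × Fin n → Set
MonoEdge {G = G} F (u , v) = (u <ᶠ v) × Adj G u v × (card (f F u ⊕ f F v) ≡ 1)

MonoCount : ∀ {n} {G : Graph n} → WeakIASI G → ℕ → Set
MonoCount {n} F m =
  Σ (List (Fin n × Fin n)) λ es →
    Unique es × length es ≡ m × ((e : Fin n × Fin n) → (e ∈ˡ es) ⇔ MonoEdge F e)

IsSparingNumber : ∀ {n} → Graph n → ℕ → Set
IsSparingNumber G m =
  Σ (WeakIASI G) (λ F → MonoCount F m) ×
  ((F : WeakIASI G) (c : ℕ) → MonoCount F c → m Data.Nat.≤ c)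

module Submission where

-- Every vertex is in K or adjacent to
-- K, so any two vertices are joined by a walk  u – x – y – v  with x, y ∈ K:
-- G has diameter at most 3 and G^k is complete for k ≥ 3.  The theorem thus
-- reduces to  φ(K_{m+1}) = m(m-1)/2, which is proved in two halves.
--  * Lower bound.  If |A|, |B| ≥ 2 then |A + B| > max(|A|, |B|), so every
--    edge of a weak IASI has a singleton-labelled endpoint.  In a complete
--    graph at most one vertex w is therefore not singleton-labelled, and all
--    C(m,2) edges avoiding w join two singletons, i.e. are mono-indexed.
--  * Upper bound.  Label vertex i by {2^(i+1)}, except vertex 0 which gets
--    {2, 3}.  Sums of two distinct powers of two are distinct (the larger
--    exponent is the leading binary digit), and parity separates the odd
--    element 3, so this is a weak IASI whose mono-indexed edges are exactly
--    the C(m,2) edges avoiding vertex 0.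
-- The file develops: counting distinct members of lists, sumset cardinality,
-- walks in split graphs, sums of powers of two, ascending pairs of vertices,
-- the two bounds for complete graphs, and finally the theorem.

open import Defs hiding (sym)
open import Data.Empty using (⊥-elim)
open import Data.Fin using (Fin; zero; suc; toℕ; punchIn) renaming (_<_ to _<ᶠ_)
import Data.Fin.Properties as Finₚ
open import Data.Fin.Subset using (Subset; _∈_; _∉_; ∣_∣; ∁)
open import Data.Fin.Subset.Properties using (_∈?_; ∣p∣≤n; ∣∁p∣≡n∸∣p∣)
open import Data.List using (List; []; _∷_; length; map; _++_; filter; tabulate; deduplicate)
open import Data.List.Extrema.Nat using (max; xs≤max; argmax-sel)
open import Data.List.Membership.Propositional using () renaming (_∈_ to _∈ˡ_)
open import Data.List.Membership.Propositional.Properties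
open import Data.List.Properties using (filter-notAll; length-map; length-++; length-tabulate)
open import Data.List.Relation.Binary.Subset.Propositional using () renaming (_⊆_ to _⊆ˡ_)
import Data.List.Relation.Unary.All as All
open import Data.List.Relation.Unary.Any as Any using (Any; here; there)
open import Data.List.Relation.Unary.AllPairs using ([]; _∷_)
open import Data.List.Relation.Unary.Unique.Propositional using (Unique)
import Data.List.Relation.Unary.Unique.Propositional.Properties as Unique
open import Data.List.Relation.Unary.Unique.DecPropositional.Properties using (deduplicate-!)
open import Data.Nat using (ℕ; zero; suc; _+_; _*_; _∸_; _≤_; _<_; _/_; _⊔_; _^_; z≤n; s≤s)
open import Data.Nat.Properties
open import Data.Nat.DivMod using (m*n/n≡m)
open import Data.Product using (Σ; _×_; _,_; proj₁; proj₂; swap)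
open import Data.Product.Properties using (≡-dec)
open import Data.Sum using (_⊎_; inj₁; inj₂)
open import Function using (_∘_)
open import Function.Bundles using (Equivalence; _⇔_; mk⇔)
open import Relation.Binary using (DecidableEquality; tri<; tri≈; tri>)
open import Relation.Binary.PropositionalEquality
open import Relation.Nullary using (¬_; yes; no; ¬?)
open import Relation.Nullary.Decidable using (decidable-stable)

unique-⊆-length : {A : Set} → DecidableEquality A → {xs ys : List A} →
                  Unique xs → xs ⊆ˡ ys → length xs ≤ length ys
unique-⊆-length _ {[]} _ _ = z≤n
unique-⊆-length _≟ᴬ_ {x ∷ xs} {ys} (x∉xs ∷ xs-unique) x∷xs⊆ys = begin-strict
    length xs       ≤⟨ unique-⊆-length _≟ᴬ_ xs-unique xs⊆ys-x ⟩
    length ys-x     <⟨ filter-notAll (λ y → ¬? (x ≟ᴬ y)) ys x∈ys ⟩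
    length ys       ∎
  where
  open ≤-Reasoning
  ys-x : List _
  ys-x = filter (λ y → ¬? (x ≟ᴬ y)) ys
  xs⊆ys-x : xs ⊆ˡ ys-x
  xs⊆ys-x y∈xs = ∈-filter⁺ (λ y → ¬? (x ≟ᴬ y)) (x∷xs⊆ys (there y∈xs)) (All.lookup x∉xs y∈xs)
  x∈ys : Any (λ y → ¬ ¬ x ≡ y) ys
  x∈ys = Any.map (λ x≡y x≢y → x≢y x≡y) (x∷xs⊆ys (here refl))

card-≥ : {xs A : FinSet} → Unique xs → xs ⊆ˡ A → length xs ≤ card A
card-≥ xs-unique xs⊆A = unique-⊆-length _≟_ xs-unique (∈-deduplicate⁺ _≟_ ∘ xs⊆A)

card-mono : {A B : FinSet} → A ⊆ˡ B → card A ≤ card B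
card-mono {A} A⊆B = card-≥ (deduplicate-! _≟_ A) (A⊆B ∘ ∈-deduplicate⁻ _≟_ A)

card-positive : {x : ℕ} {A : FinSet} → x ∈ˡ A → 1 ≤ card A
card-positive x∈A = card-≥ (All.[] ∷ []) λ { (here refl) → x∈A }

card-pair : {x y : ℕ} → x ≢ y → card (x ∷ y ∷ []) ≡ 2
card-pair {x} {y} x≢y = ≤-antisym
  (unique-⊆-length _≟_ (deduplicate-! _≟_ (x ∷ y ∷ [])) (∈-deduplicate⁻ _≟_ (x ∷ y ∷ [])))
  (card-≥ ((x≢y All.∷ All.[]) ∷ All.[] ∷ []) (λ x∈ → x∈))

card≡1⇒constant : (A : FinSet) → card A ≡ 1 → Σ ℕ λ a → ∀ {y} → y ∈ˡ A → y ≡ a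
card≡1⇒constant A card≡1 with deduplicate _≟_ A | ∈-deduplicate⁺ _≟_ {xs = A}
... | a ∷ [] | into-dedup = a , λ y∈A → single (into-dedup y∈A)
  where
  single : ∀ {y} → y ∈ˡ a ∷ [] → y ≡ a
  single (here y≡a) = y≡a
card≡1⇒constant A () | [] | _
card≡1⇒constant A () | _ ∷ _ ∷ _ | _

constant⇒card≡1 : {x a : ℕ} (A : FinSet) → x ∈ˡ A → (∀ {y} → y ∈ˡ A → y ≡ a) → card A ≡ 1
constant⇒card≡1 A x∈A constant =
  ≤-antisym (card-mono {A} {_ ∷ []} (λ y∈A → here (constant y∈A))) (card-positive x∈A)

card≢1⇒distinct : {x : ℕ} (A : FinSet) → x ∈ˡ A → card A ≢ 1 →
                  Σ ℕ λ y → Σ ℕ λ z → y ∈ˡ A × z ∈ˡ A × y ≢ z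
card≢1⇒distinct A x∈A card≢1
  with deduplicate _≟_ A | deduplicate-! _≟_ A | ∈-deduplicate⁺ _≟_ x∈A | ∈-deduplicate⁻ _≟_ A
... | y ∷ z ∷ _ | (y≢z All.∷ _) ∷ _ | _ | out-of-dedup =
      y , z , out-of-dedup (here refl) , out-of-dedup (there (here refl)) , y≢z
... | _ ∷ [] | _ | _ | _ = ⊥-elim (card≢1 refl)
... | [] | _ | () | _

-- If b₁ < b₂ lie in B and A is inhabited, then A + B contains the card A
-- distinct elements a + b₁ and, beyond all of them, max A + b₂.
sumset-grows-< : {a b₁ b₂ : ℕ} (A B : FinSet) → a ∈ˡ A → b₁ ∈ˡ B → b₂ ∈ˡ B → b₁ < b₂ →
                 suc (card A) ≤ card (A ⊕ B)
sumset-grows-< {a} {b₁} {b₂} A B a∈A b₁∈B b₂∈B b₁<b₂ =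
  subst (_≤ card (A ⊕ B)) (cong suc (length-map (_+ b₁) distinctA)) (card-≥ witnesses-unique witnesses⊆A⊕B)
  where
  distinctA : List ℕ
  distinctA = deduplicate _≟_ A
  M : ℕ
  M = max a A
  M∈A : M ∈ˡ A
  M∈A with argmax-sel (λ x → x) a A
  ... | inj₁ M≡a = subst (_∈ˡ A) (sym M≡a) a∈A
  ... | inj₂ M∈A = M∈A
  below-M : ∀ {d} → d ∈ˡ distinctA → d ≤ M
  below-M d∈ = All.lookup (xs≤max a A) (∈-deduplicate⁻ _≟_ A d∈)
  witnesses : List ℕ
  witnesses = M + b₂ ∷ map (_+ b₁) distinctA
  top-is-new : ∀ {v} → v ∈ˡ map (_+ b₁) distinctA → M + b₂ ≢ v
  top-is-new v∈ M+b₂≡v with ∈-map⁻ (_+ b₁) v∈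
  ... | d , d∈ , refl = <⇒≢ (≤-<-trans (+-monoˡ-≤ b₁ (below-M d∈)) (+-monoʳ-< M b₁<b₂)) (sym M+b₂≡v)
  witnesses-unique : Unique witnesses
  witnesses-unique = All.tabulate top-is-new ∷ Unique.map⁺ (+-cancelʳ-≡ b₁ _ _) (deduplicate-! _≟_ A)
  witnesses⊆A⊕B : witnesses ⊆ˡ A ⊕ B
  witnesses⊆A⊕B (here refl) = ∈-cartesianProductWith⁺ _+_ M∈A b₂∈B
  witnesses⊆A⊕B (there v∈) with ∈-map⁻ (_+ b₁) v∈
  ... | d , d∈ , refl = ∈-cartesianProductWith⁺ _+_ (∈-deduplicate⁻ _≟_ A d∈) b₁∈B

sumset-grows : {a b₁ b₂ : ℕ} (A B : FinSet) → a ∈ˡ A → b₁ ∈ˡ B → b₂ ∈ˡ B → b₁ ≢ b₂ →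
               suc (card A) ≤ card (A ⊕ B)
sumset-grows A B a∈A b₁∈B b₂∈B b₁≢b₂ with <-cmp _ _
... | tri< b₁<b₂ _ _ = sumset-grows-< A B a∈A b₁∈B b₂∈B b₁<b₂
... | tri≈ _ b₁≡b₂ _ = ⊥-elim (b₁≢b₂ b₁≡b₂)
... | tri> _ _ b₂<b₁ = sumset-grows-< A B a∈A b₂∈B b₁∈B b₂<b₁

⊕-comm-⊆ : (A B : FinSet) → A ⊕ B ⊆ˡ B ⊕ A
⊕-comm-⊆ A B v∈ with ∈-cartesianProductWith⁻ _+_ A B v∈
... | a , b , a∈A , b∈B , refl = subst (_∈ˡ B ⊕ A) (+-comm b a) (∈-cartesianProductWith⁺ _+_ b∈B a∈A)

-- The weakness condition |A + B| = max(|A|, |B|) forces a singleton summand: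
-- otherwise both |A| and |B| are strictly below |A + B|.
weak-sum-has-singleton : {a b : ℕ} (A B : FinSet) → a ∈ˡ A → b ∈ˡ B →
                         card (A ⊕ B) ≡ card A ⊔ card B → card A ≡ 1 ⊎ card B ≡ 1
weak-sum-has-singleton A B a∈A b∈B weak with card A ≟ 1 | card B ≟ 1
... | yes A-single | _ = inj₁ A-single
... | no _ | yes B-single = inj₂ B-single
... | no A-big | no B-big with card≢1⇒distinct A a∈A A-big | card≢1⇒distinct B b∈B B-big
... | a₁ , a₂ , a₁∈A , a₂∈A , a₁≢a₂ | b₁ , b₂ , b₁∈B , b₂∈B , b₁≢b₂ =
  ⊥-elim (<⇒≢ (⊔-lub A-grows B-grows) (sym weak))
  where
  A-grows : suc (card A) ≤ card (A ⊕ B)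
  A-grows = sumset-grows A B a₁∈A b₁∈B b₂∈B b₁≢b₂
  B-grows : suc (card B) ≤ card (A ⊕ B)
  B-grows = ≤-trans (sumset-grows B A b₁∈B a₁∈A a₂∈A a₁≢a₂) (card-mono (⊕-comm-⊆ B A))

singleton-⊕ : {a b : ℕ} (A B : FinSet) → a ∈ˡ A → b ∈ˡ B → card A ≡ 1 → card B ≡ 1 →
              card (A ⊕ B) ≡ 1
singleton-⊕ A B a∈A b∈B A-single B-single
  with card≡1⇒constant A A-single | card≡1⇒constant B B-single
... | a , A-is-a | b , B-is-b = constant⇒card≡1 (A ⊕ B) (∈-cartesianProductWith⁺ _+_ a∈A b∈B) sum-is-a+b
  where
  sum-is-a+b : ∀ {v} → v ∈ˡ A ⊕ B → v ≡ a + b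
  sum-is-a+b v∈ with ∈-cartesianProductWith⁻ _+_ A B v∈
  ... | a' , b' , a'∈A , b'∈B , refl = cong₂ _+_ (A-is-a a'∈A) (B-is-b b'∈B)

module _ {n : ℕ} {G : Graph n} (F : WeakIASI G) where

  label-inhabited : (u : Fin n) → proj₁ (nonempty F u) ∈ˡ f F u
  label-inhabited u = proj₂ (nonempty F u)

  edge-has-singleton-end : {u v : Fin n} → Adj G u v → card (f F u) ≡ 1 ⊎ card (f F v) ≡ 1
  edge-has-singleton-end {u} {v} uv =
    weak-sum-has-singleton (f F u) (f F v) (label-inhabited u) (label-inhabited v) (weak F uv)

  singleton-edge-mono : {u v : Fin n} → u <ᶠ v → Adj G u v →
                        card (f F u) ≡ 1 → card (f F v) ≡ 1 → MonoEdge F (u , v)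
  singleton-edge-mono {u} {v} u<v uv u-single v-single =
    u<v , uv , singleton-⊕ (f F u) (f F v) (label-inhabited u) (label-inhabited v) u-single v-single

IsComplete : {n : ℕ} → Graph n → Set
IsComplete {n} H = (u v : Fin n) → u ≢ v → Adj H u v

module _ {n : ℕ} {G : Graph n} where

  within-weaken : {k k' : ℕ} {u v : Fin n} → Within G k u v → k ≤ k' → Within G k' u v
  within-weaken here _ = here
  within-weaken (step uw walk) (s≤s k≤k') = step uw (within-weaken walk k≤k')

  within-++ : {a b : ℕ} {u v w : Fin n} → Within G a u v → Within G b v w → Within G (a + b) u w
  within-++ {a} {b} here walk = within-weaken walk (m≤n+m b a)
  within-++ (step uu' walk₁) walk₂ = step uu' (within-++ walk₁ walk₂)

-- In a split graph without isolated vertices every vertex is within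
-- distance one of the clique, hence any two vertices are within distance 3
-- and the k-th power is complete for k ≥ 3.
module _ {n : ℕ} (G : Graph n) (K : Subset n)
         (clique : (u v : Fin n) → u ∈ K → v ∈ K → u ≢ v → Adj G u v)
         (independent : (u v : Fin n) → u ∉ K → v ∉ K → ¬ Adj G u v)
         (no-isolated : NoIsolated G) where

  near-clique : (u : Fin n) → Σ (Fin n) λ x → x ∈ K × Within G 1 u x
  near-clique u with u ∈? K
  ... | yes u∈K = u , u∈K , here
  ... | no u∉K with no-isolated u
  ... | x , ux with x ∈? K
  ... | yes x∈K = x , x∈K , step ux here
  ... | no x∉K = ⊥-elim (independent u x u∉K x∉K ux)

  within-clique : {x y : Fin n} → x ∈ K → y ∈ K → Within G 1 x y
  within-clique {x} {y} x∈K y∈K with x Finₚ.≟ y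
  ... | yes refl = here
  ... | no x≢y = step (clique x y x∈K y∈K x≢y) here

  -- Walk u → x (≤ 1), x → y inside the clique (≤ 1), y → v (≤ 1).
  split-power-complete : (k : ℕ) → 3 ≤ k → IsComplete (G ^^ k)
  split-power-complete k 3≤k u v u≢v with near-clique u | near-clique v
  ... | x , x∈K , u→x | y , y∈K , v→y =
    u≢v , within-weaken (within-++ u→x (within-++ (within-clique x∈K y∈K) (within-rev G v→y))) 3≤k

2^-injective : {a b : ℕ} → 2 ^ a ≡ 2 ^ b → a ≡ b
2^-injective {a} {b} eq with <-cmp a b
... | tri< a<b _ _ = ⊥-elim (<⇒≢ (^-monoʳ-< 2 (s≤s (s≤s z≤n)) a<b) eq)
... | tri≈ _ a≡b _ = a≡b
... | tri> _ _ b<a = ⊥-elim (<⇒≢ (^-monoʳ-< 2 (s≤s (s≤s z≤n)) b<a) (sym eq))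

pow2-sum-< : {a b : ℕ} → a < b → 2 ^ a + 2 ^ b < 2 ^ suc b
pow2-sum-< {a} {b} a<b = begin-strict
    2 ^ a + 2 ^ b   <⟨ +-monoˡ-< (2 ^ b) (^-monoʳ-< 2 (s≤s (s≤s z≤n)) a<b) ⟩
    2 ^ b + 2 ^ b   ≡⟨ cong (2 ^ b +_) (sym (+-identityʳ (2 ^ b))) ⟩
    2 ^ suc b       ∎
  where open ≤-Reasoning

pow2-sum-leading : {a b c d : ℕ} → a < b → b < d → 2 ^ a + 2 ^ b < 2 ^ c + 2 ^ d
pow2-sum-leading {a} {b} {c} {d} a<b b<d = begin-strict
    2 ^ a + 2 ^ b   <⟨ pow2-sum-< a<b ⟩
    2 ^ suc b       ≤⟨ ^-monoʳ-≤ 2 b<d ⟩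
    2 ^ d           ≤⟨ m≤n+m (2 ^ d) (2 ^ c) ⟩
    2 ^ c + 2 ^ d   ∎
  where open ≤-Reasoning

pow2-sum-injective-< : {a b c d : ℕ} → a < b → c < d → 2 ^ a + 2 ^ b ≡ 2 ^ c + 2 ^ d →
                       a ≡ c × b ≡ d
pow2-sum-injective-< {a} {b} {c} {d} a<b c<d eq with <-cmp b d
... | tri< b<d _ _ = ⊥-elim (<⇒≢ (pow2-sum-leading {c = c} a<b b<d) eq)
... | tri> _ _ d<b = ⊥-elim (<⇒≢ (pow2-sum-leading {c = a} c<d d<b) (sym eq))
... | tri≈ _ refl _ = 2^-injective (+-cancelʳ-≡ (2 ^ b) (2 ^ a) (2 ^ c) eq) , refl

pow2-sum-injective : {a b c d : ℕ} → a ≢ b → c ≢ d → 2 ^ a + 2 ^ b ≡ 2 ^ c + 2 ^ d →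
                     (a ≡ c × b ≡ d) ⊎ (a ≡ d × b ≡ c)
pow2-sum-injective {a} {b} {c} {d} a≢b c≢d eq with <-cmp a b | <-cmp c d
... | tri≈ _ a≡b _ | _ = ⊥-elim (a≢b a≡b)
... | _ | tri≈ _ c≡d _ = ⊥-elim (c≢d c≡d)
... | tri< a<b _ _ | tri< c<d _ _ = inj₁ (pow2-sum-injective-< a<b c<d eq)
... | tri< a<b _ _ | tri> _ _ d<c = inj₂ (pow2-sum-injective-< a<b d<c (trans eq (+-comm (2 ^ c) (2 ^ d))))
... | tri> _ _ b<a | tri< c<d _ _ = inj₂ (swap (pow2-sum-injective-< b<a c<d (trans (+-comm (2 ^ b) (2 ^ a)) eq)))
... | tri> _ _ b<a | tri> _ _ d<c =
  inj₁ (swap (pow2-sum-injective-< b<a d<c (trans (+-comm (2 ^ b) (2 ^ a)) (trans eq (+-comm (2 ^ c) (2 ^ d))))))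

choose2 : ℕ → ℕ
choose2 zero = 0
choose2 (suc m) = m + choose2 m

choose2-double : (m : ℕ) → choose2 (suc m) * 2 ≡ suc m * m
choose2-double zero = refl
choose2-double (suc m) = begin
    (suc m + choose2 (suc m)) * 2   ≡⟨ *-distribʳ-+ 2 (suc m) (choose2 (suc m)) ⟩
    suc m * 2 + choose2 (suc m) * 2 ≡⟨ cong (suc m * 2 +_) (choose2-double m) ⟩
    suc m * 2 + suc m * m           ≡⟨ sym (*-distribˡ-+ (suc m) 2 m) ⟩
    suc m * (2 + m)                 ≡⟨ *-comm (suc m) (2 + m) ⟩
    (2 + m) * suc m                 ∎
  where open ≡-Reasoning

-- The closed form in which the theorem is stated, for a graph on n vertices.
choose2-closed-form : (n : ℕ) → choose2 (n ∸ 1) ≡ (n ∸ 1) * (n ∸ 2) / 2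
choose2-closed-form zero = refl
choose2-closed-form (suc zero) = refl
choose2-closed-form (suc (suc m)) = begin
    choose2 (suc m)               ≡⟨ sym (m*n/n≡m (choose2 (suc m)) 2) ⟩
    choose2 (suc m) * 2 / 2       ≡⟨ cong (_/ 2) (choose2-double m) ⟩
    suc m * m / 2                 ∎
  where open ≡-Reasoning

punch-pair : {m : ℕ} → Fin (suc m) → Fin m × Fin m → Fin (suc m) × Fin (suc m)
punch-pair w (i , j) = punchIn w i , punchIn w j

punch-pair-injective : {m : ℕ} (w : Fin (suc m)) {p q : Fin m × Fin m} → punch-pair w p ≡ punch-pair w q → p ≡ q
punch-pair-injective w {i , j} {i' , j'} eq =
  cong₂ _,_ (Finₚ.punchIn-injective w i i' (cong proj₁ eq)) (Finₚ.punchIn-injective w j j' (cong proj₂ eq))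

first-row : {m : ℕ} → Fin m → Fin (suc m) × Fin (suc m)
first-row j = zero , suc j

ascending : (m : ℕ) → List (Fin m × Fin m)
ascending zero = []
ascending (suc m) = tabulate first-row ++ map (punch-pair zero) (ascending m)

ascending-length : (m : ℕ) → length (ascending m) ≡ choose2 m
ascending-length zero = refl
ascending-length (suc m) = begin
    length (tabulate first-row ++ map (punch-pair zero) (ascending m))
      ≡⟨ length-++ (tabulate (first-row {m})) ⟩
    length (tabulate {n = m} first-row) + length (map (punch-pair zero) (ascending m))
      ≡⟨ cong₂ _+_ (length-tabulate (first-row {m})) (length-map (punch-pair zero) (ascending m)) ⟩
    m + length (ascending m)
      ≡⟨ cong (m +_) (ascending-length m) ⟩
    m + choose2 m ∎
  where open ≡-Reasoning

ascending-unique : (m : ℕ) → Unique (ascending m)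
ascending-unique zero = []
ascending-unique (suc m) =
  Unique.++⁺ (Unique.tabulate⁺ (Finₚ.suc-injective ∘ cong proj₂))
             (Unique.map⁺ (punch-pair-injective zero) (ascending-unique m))
             first-row-disjoint
  where
  first-row-disjoint : ∀ {e} → ¬ (e ∈ˡ tabulate first-row × e ∈ˡ map (punch-pair zero) (ascending m))
  first-row-disjoint (e∈first , e∈rest) with ∈-tabulate⁻ {f = first-row} e∈first | ∈-map⁻ (punch-pair zero) e∈rest
  ... | _ , refl | _ , _ , ()

ascending-sound : (m : ℕ) {i j : Fin m} → (i , j) ∈ˡ ascending m → i <ᶠ j
ascending-sound (suc m) e∈ with ∈-++⁻ (tabulate first-row) e∈
... | inj₁ e∈first with ∈-tabulate⁻ {f = first-row} e∈first
...   | _ , refl = s≤s z≤n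
ascending-sound (suc m) e∈ | inj₂ e∈rest with ∈-map⁻ (punch-pair zero) e∈rest
...   | _ , e'∈ , refl = s≤s (ascending-sound m e'∈)

ascending-complete : (m : ℕ) {i j : Fin m} → i <ᶠ j → (i , j) ∈ˡ ascending m
ascending-complete (suc m) {zero} {suc j} _ = ∈-++⁺ˡ (∈-tabulate⁺ {f = first-row} j)
ascending-complete (suc m) {suc i} {suc j} (s≤s i<j) =
  ∈-++⁺ʳ (tabulate first-row) (∈-map⁺ (punch-pair zero) (ascending-complete m i<j))

avoiding : {m : ℕ} → Fin (suc m) → List (Fin (suc m) × Fin (suc m))
avoiding {m} w = map (punch-pair w) (ascending m)

avoiding-length : {m : ℕ} (w : Fin (suc m)) → length (avoiding w) ≡ choose2 m
avoiding-length {m} w = trans (length-map (punch-pair w) (ascending m)) (ascending-length m)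

avoiding-unique : {m : ℕ} (w : Fin (suc m)) → Unique (avoiding w)
avoiding-unique {m} w = Unique.map⁺ (punch-pair-injective w) (ascending-unique m)

avoiding-sound : {m : ℕ} (w : Fin (suc m)) {u v : Fin (suc m)} → (u , v) ∈ˡ avoiding w →
                 u <ᶠ v × u ≢ w × v ≢ w
avoiding-sound {m} w e∈ with ∈-map⁻ (punch-pair w) e∈
... | (i , j) , ij∈ , refl = punchIn-< , Finₚ.punchInᵢ≢i w i , Finₚ.punchInᵢ≢i w j
  where
  i<j : i <ᶠ j
  i<j = ascending-sound m ij∈
  punchIn-< : punchIn w i <ᶠ punchIn w j
  punchIn-< = Finₚ.≤∧≢⇒< (Finₚ.punchIn-mono-≤ w i j (<⇒≤ i<j))
                         (Finₚ.<⇒≢ i<j ∘ Finₚ.punchIn-injective w i j)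

module _ {m : ℕ} {H : Graph (suc m)} (complete : IsComplete H) (F : WeakIASI H) where

  -- All vertices but possibly one (w) carry singleton labels, since every
  -- edge has a singleton-labelled end.
  all-singleton-but-one : Σ (Fin (suc m)) λ w → (u : Fin (suc m)) → u ≢ w → card (f F u) ≡ 1
  all-singleton-but-one with Finₚ.any? (λ w → ¬? (card (f F w) ≟ 1))
  ... | yes (w , w-big) = w , λ u u≢w → singleton-end u≢w (edge-has-singleton-end F (complete u w u≢w))
    where
    singleton-end : {u : Fin (suc m)} → u ≢ w → card (f F u) ≡ 1 ⊎ card (f F w) ≡ 1 → card (f F u) ≡ 1
    singleton-end _ (inj₁ u-single) = u-single
    singleton-end _ (inj₂ w-single) = ⊥-elim (w-big w-single)
  ... | no no-big = zero , λ u _ → decidable-stable (card (f F u) ≟ 1) (λ u-big → no-big (u , u-big))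

  -- The C(m, 2) ascending pairs avoiding w are all mono-indexed edges.
  sparing-lower-bound : (c : ℕ) → MonoCount F c → choose2 m ≤ c
  sparing-lower-bound c (mono-edges , mono-unique , mono-length , mono-spec) = begin
      choose2 m                ≡⟨ sym (avoiding-length w) ⟩
      length (avoiding w)      ≤⟨ unique-⊆-length (≡-dec Finₚ._≟_ Finₚ._≟_) (avoiding-unique w) avoiding⊆mono ⟩
      length mono-edges        ≡⟨ mono-length ⟩
      c                        ∎
    where
    open ≤-Reasoning
    w : Fin (suc m)
    w = proj₁ all-singleton-but-one
    avoiding⊆mono : avoiding w ⊆ˡ mono-edges
    avoiding⊆mono {u , v} e∈ with avoiding-sound w e∈
    ... | u<v , u≢w , v≢w = Equivalence.from (mono-spec (u , v))
      (singleton-edge-mono F u<v (complete u v (Finₚ.<⇒≢ u<v))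
        (proj₂ all-singleton-but-one u u≢w) (proj₂ all-singleton-but-one v v≢w))

module PowerOfTwoLabelling {m : ℕ} (H : Graph (suc m)) (complete : IsComplete H) where

  code : Fin (suc m) → ℕ
  code u = 2 * 2 ^ toℕ u

  label : Fin (suc m) → FinSet
  label zero = code zero ∷ suc (code zero) ∷ []
  label (suc i) = code (suc i) ∷ []

  code∈label : (u : Fin (suc m)) → code u ∈ˡ label u
  code∈label zero = here refl
  code∈label (suc i) = here refl

  label-members : {a : ℕ} (u : Fin (suc m)) → a ∈ˡ label u → a ≡ code u ⊎ (u ≡ zero × a ≡ suc (code u))
  label-members zero (here refl) = inj₁ refl
  label-members zero (there (here refl)) = inj₂ (refl , refl)
  label-members (suc i) (here refl) = inj₁ refl

  code-injective : {u v : Fin (suc m)} → code u ≡ code v → u ≡ v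
  code-injective eq = Finₚ.toℕ-injective (2^-injective (*-cancelˡ-≡ _ _ 2 eq))

  code-sum : (u v : Fin (suc m)) → code u + code v ≡ 2 * (2 ^ toℕ u + 2 ^ toℕ v)
  code-sum u v = sym (*-distribˡ-+ 2 (2 ^ toℕ u) (2 ^ toℕ v))

  adjacent-distinct : {u v : Fin (suc m)} → Adj H u v → toℕ u ≢ toℕ v
  adjacent-distinct uv eq with Finₚ.toℕ-injective eq
  ... | refl = irrefl H uv

  -- Equal labels share their even code.
  label-injective : (u v : Fin (suc m)) → label u ≈ˢ label v → u ≡ v
  label-injective u v same with label-members v (Equivalence.to (same (code u)) (code∈label u))
  ... | inj₁ codes-equal = code-injective codes-equal
  ... | inj₂ (_ , even≡odd) = ⊥-elim (even≢odd (2 ^ toℕ u) (2 ^ toℕ v) even≡odd)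

  -- Equal edge labels share the even element code u + code v; by the Sidon
  -- property of powers of two the edges coincide.
  label⁺-injective : {u v u' v' : Fin (suc m)} → Adj H u v → Adj H u' v' →
                     (label u ⊕ label v) ≈ˢ (label u' ⊕ label v') →
                     ((u ≡ u') × (v ≡ v')) ⊎ ((u ≡ v') × (v ≡ u'))
  label⁺-injective {u} {v} {u'} {v'} uv u'v' same
    with ∈-cartesianProductWith⁻ _+_ (label u') (label v')
           (Equivalence.to (same (code u + code v)) (∈-cartesianProductWith⁺ _+_ (code∈label u) (code∈label v)))
  ... | x , y , x∈ , y∈ , sum≡ with label-members u' x∈ | label-members v' y∈
  ... | inj₁ refl | inj₁ refl =
    from-toℕ (pow2-sum-injective (adjacent-distinct uv) (adjacent-distinct u'v')
      (*-cancelˡ-≡ _ _ 2 (trans (sym (code-sum u v)) (trans sum≡ (code-sum u' v')))))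
    where
    from-toℕ : ((toℕ u ≡ toℕ u') × (toℕ v ≡ toℕ v')) ⊎ ((toℕ u ≡ toℕ v') × (toℕ v ≡ toℕ u')) →
               ((u ≡ u') × (v ≡ v')) ⊎ ((u ≡ v') × (v ≡ u'))
    from-toℕ (inj₁ (p , q)) = inj₁ (Finₚ.toℕ-injective p , Finₚ.toℕ-injective q)
    from-toℕ (inj₂ (p , q)) = inj₂ (Finₚ.toℕ-injective p , Finₚ.toℕ-injective q)
  ... | inj₁ refl | inj₂ (_ , refl) = ⊥-elim (even≢odd (2 ^ toℕ u + 2 ^ toℕ v) (2 ^ toℕ u' + 2 ^ toℕ v')
    (trans (sym (code-sum u v)) (trans sum≡ (trans (+-suc (code u') (code v')) (cong suc (code-sum u' v'))))))
  ... | inj₂ (_ , refl) | inj₁ refl = ⊥-elim (even≢odd (2 ^ toℕ u + 2 ^ toℕ v) (2 ^ toℕ u' + 2 ^ toℕ v')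
    (trans (sym (code-sum u v)) (trans sum≡ (cong suc (code-sum u' v')))))
  ... | inj₂ (u'≡0 , _) | inj₂ (v'≡0 , _) = ⊥-elim (irrefl H (subst (Adj H u') (trans v'≡0 (sym u'≡0)) u'v'))

  -- Only edges at vertex 0 have a two-element sumset, so the labelling is weak.
  label-weak : {u v : Fin (suc m)} → Adj H u v → card (label u ⊕ label v) ≡ card (label u) ⊔ card (label v)
  label-weak {zero} {zero} uv = ⊥-elim (irrefl H uv)
  label-weak {zero} {suc j} _ = card-pair (m≢1+n+m (2 + code (suc j)) {0})
  label-weak {suc i} {zero} _ = card-pair (m≢1+n+m (code (suc i) + 2) {0} ∘ (λ eq → trans eq (+-suc (code (suc i)) 2)))
  label-weak {suc i} {suc j} _ = refl

  labelling : WeakIASI H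
  labelling = record
    { f        = label
    ; nonempty = λ u → code u , code∈label u
    ; f-inj    = label-injective
    ; f⁺-inj   = label⁺-injective
    ; weak     = label-weak
    }

  mono-edges-avoid-zero : (e : Fin (suc m) × Fin (suc m)) → e ∈ˡ avoiding zero ⇔ MonoEdge labelling e
  mono-edges-avoid-zero (u , v) = mk⇔ to from
    where
    nonzero-single : {x : Fin (suc m)} → x ≢ zero → card (label x) ≡ 1
    nonzero-single {zero} x≢0 = ⊥-elim (x≢0 refl)
    nonzero-single {suc _} _ = refl
    to : (u , v) ∈ˡ avoiding zero → MonoEdge labelling (u , v)
    to e∈ with avoiding-sound zero e∈
    ... | u<v , u≢0 , v≢0 =
      singleton-edge-mono labelling u<v (complete u v (Finₚ.<⇒≢ u<v)) (nonzero-single u≢0) (nonzero-single v≢0)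
    from : ∀ {u v} → MonoEdge labelling (u , v) → (u , v) ∈ˡ avoiding zero
    from {zero} {zero} (() , _ , _)
    from {zero} {suc j} (_ , uv , mono) with () ← trans (sym (label-weak uv)) mono
    from {suc i} {zero} (() , _ , _)
    from {suc i} {suc j} (s≤s i<j , _ , _) = ∈-map⁺ (punch-pair zero) (ascending-complete m i<j)

  sparing-upper-bound : MonoCount labelling (choose2 m)
  sparing-upper-bound = avoiding zero , avoiding-unique (zero {m}) , avoiding-length (zero {m}) , mono-edges-avoid-zero

empty-sparing : (H : Graph 0) → IsSparingNumber H 0
empty-sparing H = (empty-labelling , [] , [] , refl , no-edges) , λ _ _ _ → z≤n
  where
  empty-labelling : WeakIASI H
  empty-labelling = record
    { f = λ () ; nonempty = λ () ; f-inj = λ () ; f⁺-inj = λ {u} → ⊥-elim (Finₚ.¬Fin0 u)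
    ; weak = λ {u} → ⊥-elim (Finₚ.¬Fin0 u) }
  no-edges : (e : Fin 0 × Fin 0) → e ∈ˡ [] ⇔ MonoEdge empty-labelling e
  no-edges (() , _)

complete-sparing : (n : ℕ) (H : Graph n) → IsComplete H → IsSparingNumber H (choose2 (n ∸ 1))
complete-sparing zero H _ = empty-sparing H
complete-sparing (suc m) H complete =
  (labelling , sparing-upper-bound) , sparing-lower-bound complete
  where open PowerOfTwoLabelling H complete

mainTheorem11 : (n : ℕ) (G : Graph n) (K : Subset n) →
    ((u v : Fin n) → u ∈ K → v ∈ K → u ≢ v → Adj G u v) →
    ((u v : Fin n) → u ∉ K → v ∉ K → ¬ Adj G u v) →
    NoIsolated G →
    (k : ℕ) → 3 ≤ k →
    IsSparingNumber (G ^^ k) ((∣ K ∣ + ∣ ∁ K ∣ ∸ 1) * (∣ K ∣ + ∣ ∁ K ∣ ∸ 2) / 2)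
mainTheorem11 n G K clique independent no-isolated k 3≤k =
  subst (λ N → IsSparingNumber (G ^^ k) ((N ∸ 1) * (N ∸ 2) / 2)) (sym vertex-count)
    (subst (IsSparingNumber (G ^^ k)) (choose2-closed-form n)
      (complete-sparing n (G ^^ k) (split-power-complete G K clique independent no-isolated k 3≤k)))
  where
  vertex-count : ∣ K ∣ + ∣ ∁ K ∣ ≡ n
  vertex-count = trans (cong (∣ K ∣ +_) (∣∁p∣≡n∸∣p∣ K)) (m+[n∸m]≡n (∣p∣≤n K))
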